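{- Let $w$ be a string over $\{0,1\}$ with $\#w\ge1$ such that $l(w)$ and $r(w)$ are both colourable. Then $\psi(l(w))\neq\psi(r(w))$.
   Context: $\#w$ is the length, $\varepsilon$ the empty string; for $\#w\ge1$, $l(w)$ is $w$ without its last letter and $r(w)$ is $w$ without its first letter. $T^n$ is the alternating string of length $n$ starting with $0$ ($T^0=\varepsilon$, $T^n=T^{n-1}0$ for odd $n$, $T^n=T^{n-1}1$ for even $n\ge2$) and $CT^n$ its letterwise complement. $\xi$: $\xi(\varepsilon)=0$; $\xi(w)=1$ if $w=T^k$, $k\ge2$ even; $\xi(w)=-1$ if $w=CT^k$, $k\ge2$ even; otherwise $\xi(w)=\operatorname{sgn}(\xi(l(w))+\xi(r(w)))$. $\phi$: $\phi(\varepsilon)=0$; $\phi(w)=-1$ if $w=0^k$, $k$ odd; $\phi(w)=1$ if $w=1^k$, $k$ odd; otherwise $\phi(w)=\operatorname{sgn}(\phi(r(w))-\phi(l(w)))$. $\psi(w)=\xi(w)^{\#w}\phi(w)$ (with $0^0=1$); $w$ is colourable iff $\psi(w)\ne0$. -}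

module Defs where

-- Binary strings of length n are  Vec Bool n  with  false = 0, true = 1.
-- #w = n, l = init (drop last letter), r = tail (drop first letter).

open import Data.Bool using (Bool; true; false; if_then_else_; not; _∧_)
import Data.Bool.Properties as BoolP
open import Data.Nat using (ℕ; zero; suc)
open import Data.Integer using (ℤ; 0ℤ; 1ℤ; -1ℤ; +_; -[1+_]; _+_; _-_; _^_)
open import Data.Vec using (Vec; []; _∷_; _∷ʳ_; init; tail; replicate; map)
open import Data.Vec.Properties using (≡-dec)
open import Relation.Nullary using (yes; no; ¬_)
open import Relation.Binary.PropositionalEquality using (_≡_)

even : ℕ → Bool
even zero = true
even (suc n) = not (even n)

sgn : ℤ → ℤ
sgn (+ zero) = 0ℤ
sgn (+ suc _) = 1ℤ
sgn -[1+ _ ] = -1ℤ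

-- T^n : alternating string of length n starting with 0
T : (n : ℕ) → Vec Bool n
T zero = []
T (suc n) = T n ∷ʳ (if even (suc n) then true else false)

CT : (n : ℕ) → Vec Bool n
CT n = map not (T n)

evenAtLeast2 : ℕ → Bool
evenAtLeast2 zero = false
evenAtLeast2 (suc zero) = false
evenAtLeast2 (suc (suc n)) = even n

_≟ᵥ_ : ∀ {n} (u v : Vec Bool n) → _
_≟ᵥ_ = ≡-dec BoolP._≟_

ξ : ∀ {n} → Vec Bool n → ℤ
ξ {zero} [] = 0ℤ
ξ {suc k} w with evenAtLeast2 (suc k) | w ≟ᵥ T (suc k) | w ≟ᵥ CT (suc k)
... | true | yes _ | _ = 1ℤ
... | true | no _ | yes _ = -1ℤ
... | _ | _ | _ = sgn (ξ (init w) + ξ (tail w))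

φ : ∀ {n} → Vec Bool n → ℤ
φ {zero} [] = 0ℤ
φ {suc k} w with even (suc k) | w ≟ᵥ replicate (suc k) false | w ≟ᵥ replicate (suc k) true
... | false | yes _ | _ = -1ℤ
... | false | no _ | yes _ = 1ℤ
... | _ | _ | _ = sgn (φ (tail w) - φ (init w))

-- ψ(w) = ξ(w)^{#w} φ(w)   (stdlib: x ^ 0 = 1, so 0^0 = 1)
ψ : ∀ {n} → Vec Bool n → ℤ
ψ {n} w = (ξ w ^ n) Data.Integer.* φ w

Colourable : ∀ {n} → Vec Bool n → Set
Colourable w = ¬ (ψ w ≡ 0ℤ)

-- Write ll = l∘l, rr = r∘r and mid = l∘r.
--
-- On words of odd length φ never vanishes: for non-constant u one has
-- φ(u) = −φ(mid u), since φ(ll u), φ(mid u), φ(rr u) are non-zero and, by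
-- induction, not all equal.  If #w is odd, then l(w), r(w) have even length,
-- ψ = ξ²φ there, and colourability forces φ(l w) = φ(r w); but for
-- non-constant w, φ(w) = sgn(φ(r w) − φ(l w)) ≠ 0.
--
-- If #w is even, ψ = ξφ on l(w), r(w), and ξ(l w), ξ(r w), φ(l w), φ(r w)
-- are sign combinations of the values of ξ and φ on ll w, mid w, rr w.  What
-- remains is sign arithmetic, given two facts about even words u: ξ(u) = 0
-- iff φ(u) = 0, and ξ(mid u) = 0 with ξ(ll u), ξ(rr u) ≠ 0 forces
-- ξ(rr u) = −ξ(ll u).  Both come from the invariant InnerSigns: the triple
-- (ξ(ll u), ξ(mid u), ξ(rr u)) is degenerate only when u is alternating or of
-- the shape a…aā or aā…ā.  It is proved by induction, since on even words
-- ξ(u) is a fixed function (ξ-recurrence) of that triple.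

module Submission where

open import Defs
open import Data.Bool using (Bool; true; false; not; if_then_else_)
import Data.Bool as Bool
open import Data.Bool.Properties using (not-involutive)
open import Data.Empty using (⊥; ⊥-elim)
open import Data.Integer as ℤ using (ℤ; 0ℤ; 1ℤ; -1ℤ; _+_; _-_; _*_; _^_)
import Data.Integer.Properties as ℤ
open import Data.Nat using (ℕ; zero; suc)
open import Data.Product using (Σ; _×_; _,_; proj₁; proj₂)
open import Data.Sum using (_⊎_; inj₁; inj₂)
open import Data.Vec using (Vec; []; _∷_; _∷ʳ_; init; tail; head; last; replicate; map; initLast)
open import Data.Vec.Properties using (init-∷ʳ; last-∷ʳ)
open import Function using (_⇔_; mk⇔; Equivalence; case_of_)
open import Function.Properties.Equivalence using (⇔-setoid)
open import Level using (0ℓ)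
open import Relation.Nullary using (¬_; Dec; yes; no)
open import Relation.Nullary.Decidable using (_×-dec_; _⊎-dec_; _→-dec_; True; toWitness; map′)
open import Relation.Binary.PropositionalEquality using (_≡_; _≢_; refl; sym; trans; cong; cong₂; subst; module ≡-Reasoning)

data Trit : Set where
  ⊖ ⊙ ⊕ : Trit

⟦_⟧ : Trit → ℤ
⟦ ⊖ ⟧ = -1ℤ
⟦ ⊙ ⟧ = 0ℤ
⟦ ⊕ ⟧ = 1ℤ

infix  8 -ₜ_
infixl 7 _⊠_
infixl 6 _⊞_ _⊟_

-ₜ_ : Trit → Trit
-ₜ ⊖ = ⊕
-ₜ ⊙ = ⊙
-ₜ ⊕ = ⊖

_⊞_ : Trit → Trit → Trit
⊙ ⊞ b = b
a ⊞ ⊙ = a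
⊖ ⊞ ⊖ = ⊖
⊖ ⊞ ⊕ = ⊙
⊕ ⊞ ⊖ = ⊙
⊕ ⊞ ⊕ = ⊕

_⊟_ : Trit → Trit → Trit
a ⊟ b = a ⊞ -ₜ b

_⊠_ : Trit → Trit → Trit
⊖ ⊠ b = -ₜ b
⊙ ⊠ b = ⊙
⊕ ⊠ b = b

sign : Bool → Trit
sign false = ⊖
sign true  = ⊕

infix 4 _≟ₜ_
_≟ₜ_ : (a b : Trit) → Dec (a ≡ b)
⊖ ≟ₜ ⊖ = yes refl
⊖ ≟ₜ ⊙ = no λ ()
⊖ ≟ₜ ⊕ = no λ ()
⊙ ≟ₜ ⊖ = no λ ()
⊙ ≟ₜ ⊙ = yes refl
⊙ ≟ₜ ⊕ = no λ ()
⊕ ≟ₜ ⊖ = no λ ()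
⊕ ≟ₜ ⊙ = no λ ()
⊕ ≟ₜ ⊕ = yes refl

-- Finite facts about signs (and about short words) are proved by exhaustive
-- evaluation: instance search assembles a decision procedure for the
-- statement and `decide` extracts the proof from its `yes` answer.
module Enumeration where
  instance
    dec-≡ₜ : {a b : Trit} → Dec (a ≡ b)
    dec-≡ₜ {a} {b} = a ≟ₜ b

    dec-≡ℤ : {x y : ℤ} → Dec (x ≡ y)
    dec-≡ℤ {x} {y} = x ℤ.≟ y

    dec-≡ᵥ : {n : ℕ} {u v : Vec Bool n} → Dec (u ≡ v)
    dec-≡ᵥ {u = u} {v} = u ≟ᵥ v

    dec-⊥ : Dec ⊥
    dec-⊥ = no λ ()

    dec-→ : {A B : Set} → {{Dec A}} → {{Dec B}} → Dec (A → B)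
    dec-→ {{a?}} {{b?}} = a? →-dec b?

    dec-× : {A B : Set} → {{Dec A}} → {{Dec B}} → Dec (A × B)
    dec-× {{a?}} {{b?}} = a? ×-dec b?

    dec-⊎ : {A B : Set} → {{Dec A}} → {{Dec B}} → Dec (A ⊎ B)
    dec-⊎ {{a?}} {{b?}} = a? ⊎-dec b?

    dec-∀ₜ : {P : Trit → Set} → {{∀ {t} → Dec (P t)}} → Dec (∀ t → P t)
    dec-∀ₜ {{p?}} with p? {⊖} | p? {⊙} | p? {⊕}
    ... | yes p | yes q | yes r = yes λ { ⊖ → p ; ⊙ → q ; ⊕ → r }
    ... | no ¬p | _     | _     = no λ f → ¬p (f ⊖)
    ... | yes _ | no ¬q | _     = no λ f → ¬q (f ⊙)
    ... | yes _ | yes _ | no ¬r = no λ f → ¬r (f ⊕)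

    dec-ΣBool : {P : Bool → Set} → {{∀ {b} → Dec (P b)}} → Dec (Σ Bool P)
    dec-ΣBool {{p?}} with p? {false} | p? {true}
    ... | yes p | _     = yes (false , p)
    ... | no _  | yes q = yes (true , q)
    ... | no ¬p | no ¬q = no λ { (false , p) → ¬p p ; (true , q) → ¬q q }

    dec-∀ᵥ : {n : ℕ} {P : Vec Bool n → Set} → {{∀ {v} → Dec (P v)}} → Dec (∀ v → P v)
    dec-∀ᵥ {zero} {{p?}} = map′ (λ { p [] → p }) (λ f → f []) p?
    dec-∀ᵥ {suc n} {P} {{p?}} =
      map′ (λ f → λ { (b ∷ v) → f b v }) (λ f b v → f (b ∷ v))
           (dec-∀Bool {{dec-∀ᵥ {n} {{p?}}}})
      where
      dec-∀Bool : {Q : Bool → Set} → {{∀ {b} → Dec (Q b)}} → Dec (∀ b → Q b)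
      dec-∀Bool {{q?}} with q? {false} | q? {true}
      ... | yes p | yes q = yes λ { false → p ; true → q }
      ... | no ¬p | _     = no λ f → ¬p (f false)
      ... | yes _ | no ¬q = no λ f → ¬q (f true)

  decide : {A : Set} {{a? : Dec A}} → {True a?} → A
  decide {{a?}} {p} = toWitness p

open Enumeration

⟦⟧-injective : ∀ a b → ⟦ a ⟧ ≡ ⟦ b ⟧ → a ≡ b
⟦⟧-injective = decide

sgn-⟦⟧+⟦⟧ : ∀ {x y} a b → x ≡ ⟦ a ⟧ → y ≡ ⟦ b ⟧ → sgn (x + y) ≡ ⟦ a ⊞ b ⟧
sgn-⟦⟧+⟦⟧ a b refl refl = sgn-⟦+⟧ a b
  where
  sgn-⟦+⟧ : ∀ a b → sgn (⟦ a ⟧ + ⟦ b ⟧) ≡ ⟦ a ⊞ b ⟧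
  sgn-⟦+⟧ = decide

sgn-⟦⟧-⟦⟧ : ∀ {x y} a b → x ≡ ⟦ a ⟧ → y ≡ ⟦ b ⟧ → sgn (x - y) ≡ ⟦ a ⊟ b ⟧
sgn-⟦⟧-⟦⟧ a b refl refl = sgn-⟦-⟧ a b
  where
  sgn-⟦-⟧ : ∀ a b → sgn (⟦ a ⟧ - ⟦ b ⟧) ≡ ⟦ a ⊟ b ⟧
  sgn-⟦-⟧ = decide

⟦⟧*⟦⟧ : ∀ a b → ⟦ a ⟧ * ⟦ b ⟧ ≡ ⟦ a ⊠ b ⟧
⟦⟧*⟦⟧ = decide

sign≢⊙ : ∀ c → sign c ≢ ⊙
sign≢⊙ false ()
sign≢⊙ true  ()

-ₜ-≢⊙ : ∀ t → t ≢ ⊙ → -ₜ t ≢ ⊙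
-ₜ-≢⊙ = decide

≢⊙⇒≢-ₜ : ∀ t → t ≢ ⊙ → t ≢ -ₜ t
≢⊙⇒≢-ₜ = decide

-ₜ-injective : ∀ a b → -ₜ a ≡ -ₜ b → a ≡ b
-ₜ-injective = decide

subst₃ : ∀ (P : Trit → Trit → Trit → Set) {a a′ b b′ c c′} →
         a ≡ a′ → b ≡ b′ → c ≡ c′ → P a b c → P a′ b′ c′
subst₃ P refl refl refl p = p

twice : ℕ → ℕ
twice zero    = zero
twice (suc k) = suc (suc (twice k))

even-twice : ∀ k → even (twice k) ≡ true
even-twice zero    = refl
even-twice (suc k) = cong (λ b → not (not b)) (even-twice k)

even-suc-twice : ∀ k → even (suc (twice k)) ≡ false
even-suc-twice k = cong not (even-twice k)

evenAtLeast2-suc-twice : ∀ k → evenAtLeast2 (suc (twice k)) ≡ false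
evenAtLeast2-suc-twice zero    = refl
evenAtLeast2-suc-twice (suc k) = even-suc-twice k

data Parity : ℕ → Set where
  even-length : ∀ k → Parity (twice k)
  odd-length  : ∀ k → Parity (suc (twice k))

parity : ∀ n → Parity n
parity zero = even-length zero
parity (suc n) with parity n
... | even-length k = odd-length k
... | odd-length k  = even-length (suc k)

not-fixed : ∀ b → b ≢ not b
not-fixed false ()
not-fixed true  ()

≢⇒≡not : ∀ {a b} → a ≢ b → b ≡ not a
≢⇒≡not {false} {false} a≢b = ⊥-elim (a≢b refl)
≢⇒≡not {false} {true}  _   = refl
≢⇒≡not {true}  {false} _   = refl
≢⇒≡not {true}  {true}  a≢b = ⊥-elim (a≢b refl)

head-view : ∀ {A : Set} {n} (u : Vec A (suc n)) → u ≡ head u ∷ tail u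
head-view (x ∷ v) = refl

last-view : ∀ {A : Set} {n} (u : Vec A (suc n)) → u ≡ init u ∷ʳ last u
last-view u = proj₂ (proj₂ (initLast u))

init-replicate : ∀ {A : Set} n (c : A) → init (replicate (suc n) c) ≡ replicate n c
init-replicate zero    c = refl
init-replicate (suc n) c = cong (c ∷_) (init-replicate n c)

replicate-∷ʳ : ∀ {A : Set} n (c : A) → replicate n c ∷ʳ c ≡ replicate (suc n) c
replicate-∷ʳ zero    c = refl
replicate-∷ʳ (suc n) c = cong (c ∷_) (replicate-∷ʳ n c)

last-replicate : ∀ {A : Set} n (c : A) → last (replicate (suc n) c) ≡ c
last-replicate n c = trans (cong last (sym (replicate-∷ʳ n c))) (last-∷ʳ c (replicate n c))

ll rr mid : ∀ {A : Set} {n} → Vec A (suc (suc n)) → Vec A n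
ll  w = init (init w)
rr  w = tail (tail w)
mid w = init (tail w)

snoc-view₂ : ∀ {A : Set} {n} (w : Vec A (suc (suc n))) → w ≡ (ll w ∷ʳ last (init w)) ∷ʳ last w
snoc-view₂ w = trans (proj₂ (proj₂ (initLast w))) (cong (_∷ʳ last w) (proj₂ (proj₂ (initLast (init w)))))

tail-init : ∀ {A : Set} {n} (v : Vec A (suc (suc n))) → tail (init v) ≡ init (tail v)
tail-init (x ∷ v) = refl

tail-ll : ∀ {A : Set} {n} (u : Vec A (suc (suc (suc n)))) → tail (ll u) ≡ ll (tail u)
tail-ll u = trans (tail-init (init u)) (cong init (tail-init u))

mid-ll : ∀ {A : Set} {n} (u : Vec A (suc (suc (suc (suc n))))) → mid (ll u) ≡ ll (mid u)
mid-ll (x ∷ y ∷ v) = refl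

mid-rr : ∀ {A : Set} {n} (u : Vec A (suc (suc (suc (suc n))))) → mid (rr u) ≡ rr (mid u)
mid-rr (x ∷ y ∷ v) = sym (tail-init v)

rr-ll : ∀ {A : Set} {n} (u : Vec A (suc (suc (suc (suc n))))) → rr (ll u) ≡ mid (mid u)
rr-ll (x ∷ y ∷ v) = refl

ll-rr : ∀ {A : Set} {n} (u : Vec A (suc (suc (suc (suc n))))) → ll (rr u) ≡ mid (mid u)
ll-rr (x ∷ y ∷ v) = refl

ll-replicate : ∀ {A : Set} n (c : A) → ll (replicate (suc (suc n)) c) ≡ replicate n c
ll-replicate n c = trans (cong init (init-replicate (suc n) c)) (init-replicate n c)

ll-replicate-∷ʳ : ∀ {A : Set} n (a z : A) → ll (replicate (suc n) a ∷ʳ z) ≡ replicate n a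
ll-replicate-∷ʳ n a z = trans (cong init (init-∷ʳ z (replicate (suc n) a))) (init-replicate n a)

head-rr-ll : ∀ {A : Set} {n} (w : Vec A (suc (suc (suc (suc (suc n)))))) → head (rr w) ≡ head (rr (ll w))
head-rr-ll (x ∷ y ∷ z ∷ v) = refl

alt : Bool → (n : ℕ) → Vec Bool n
alt b zero    = []
alt b (suc n) = b ∷ alt (not b) n

alt-∷ʳ : ∀ b n → alt b (suc n) ≡ alt b n ∷ʳ (if even n then b else not b)
alt-∷ʳ b zero    = refl
alt-∷ʳ b (suc n) = cong (b ∷_) (trans (alt-∷ʳ (not b) n) (cong (alt (not b) n ∷ʳ_) (lemma (even n))))
  where lemma : ∀ e → (if e then not b else not (not b)) ≡ (if not e then b else not b)
        lemma true  = refl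
        lemma false = not-involutive b

map-not-alt : ∀ b n → map not (alt b n) ≡ alt (not b) n
map-not-alt b zero    = refl
map-not-alt b (suc n) = cong (not b ∷_) (map-not-alt (not b) n)

init-alt : ∀ b n → init (alt b (suc n)) ≡ alt b n
init-alt b zero    = refl
init-alt b (suc n) = cong (b ∷_) (init-alt (not b) n)

alt-injective : ∀ {b b′} n → alt b (suc n) ≡ alt b′ (suc n) → b ≡ b′
alt-injective n = cong head

ll-alt : ∀ b n → ll (alt b (suc (suc n))) ≡ alt b n
ll-alt b n = trans (cong init (init-alt b (suc n))) (init-alt b n)

mid-alt : ∀ b n → mid (alt b (suc (suc n))) ≡ alt (not b) n
mid-alt b n = init-alt (not b) n

rr-alt : ∀ b n → rr (alt b (suc (suc n))) ≡ alt b n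
rr-alt b n = cong (λ c → alt c n) (not-involutive b)

IsAlternating : ∀ {n} → Vec Bool n → Set
IsAlternating {n} w = Σ Bool λ b → w ≡ alt b n

alternating? : ∀ {n} (w : Vec Bool n) → Dec (IsAlternating w)
alternating? w = dec-ΣBool

IsConstant : ∀ {n} → Vec Bool n → Set
IsConstant {n} w = Σ Bool λ c → w ≡ replicate n c

constant? : ∀ {n} (w : Vec Bool n) → Dec (IsConstant w)
constant? w = dec-ΣBool

LastFlipped : ∀ {n} → Vec Bool (suc n) → Set
LastFlipped {n} w = Σ Bool λ a → w ≡ replicate n a ∷ʳ not a

FirstFlipped : ∀ {n} → Vec Bool (suc n) → Set
FirstFlipped {n} w = Σ Bool λ a → w ≡ a ∷ replicate n (not a)

repeated-¬alternating : ∀ {n} c (v : Vec Bool n) → ¬ IsAlternating (c ∷ c ∷ v)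
repeated-¬alternating c v (b , eq) = not-fixed b (trans (sym (cong head eq)) (cong (λ u → head (tail u)) eq))

∷-repeated-¬alternating : ∀ {n} x c (v : Vec Bool n) → ¬ IsAlternating (x ∷ c ∷ c ∷ v)
∷-repeated-¬alternating x c v (b , eq) = repeated-¬alternating c v (not b , cong tail eq)

glue-constant : ∀ {n x y} (u : Vec Bool (suc (suc (suc n)))) →
                init u ≡ replicate _ x → tail u ≡ replicate _ y → u ≡ replicate _ x
glue-constant (a ∷ v) init≡x refl with cong head init≡x | cong (λ v → head (tail v)) init≡x
... | refl | refl = refl

alternating-glue : ∀ {n} (w : Vec Bool (suc (suc (suc (suc (suc n)))))) →
                   IsAlternating (ll w) → IsAlternating (rr w) → IsAlternating w
alternating-glue {n} (x ∷ y ∷ v) (b , ll≡) (b′ , refl) with cong head ll≡ | cong (λ u → head (tail u)) ll≡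
... | refl | refl = b , cong (λ c → b ∷ not b ∷ alt c _) b′≡not-not-b
  where
  b′≡not-not-b : b′ ≡ not (not b)
  b′≡not-not-b = alt-injective n (trans (sym (ll-alt b′ (suc n))) (cong rr ll≡))

last-flipped-nonconstant : ∀ {n} (w : Vec Bool (suc (suc n))) → LastFlipped w → ¬ IsConstant w
last-flipped-nonconstant {n} w (a , refl) (d , eq) = not-fixed a (begin
  a              ≡⟨ cong head eq ⟩
  d              ≡⟨ sym (last-replicate (suc n) d) ⟩
  last (replicate (suc (suc n)) d) ≡⟨ cong last (sym eq) ⟩
  last w         ≡⟨ last-∷ʳ (not a) (replicate (suc n) a) ⟩
  not a          ∎)
  where open ≡-Reasoning

first-flipped-nonconstant : ∀ {n} (w : Vec Bool (suc (suc n))) → FirstFlipped w → ¬ IsConstant w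
first-flipped-nonconstant w (a , refl) (d , eq) = not-fixed a (trans (cong head eq) (sym (cong (λ u → head (tail u)) eq)))

shape-cases : ∀ {n} (u : Vec Bool (suc n)) →
              IsConstant u ⊎ LastFlipped u ⊎ FirstFlipped u ⊎ (¬ IsConstant (init u) × ¬ IsConstant (tail u))
shape-cases u with constant? (init u) | constant? (tail u)
... | yes (c , init≡c) | _ with c Bool.≟ last u
...   | yes c≡last = inj₁ (c , trans (last-view u) (trans (cong₂ _∷ʳ_ init≡c (sym c≡last)) (replicate-∷ʳ _ c)))
...   | no c≢last  = inj₂ (inj₁ (c , trans (last-view u) (cong₂ _∷ʳ_ init≡c (≢⇒≡not c≢last))))
shape-cases u | no ¬cᵢ | yes (c , tail≡c) with head u Bool.≟ c
...   | yes head≡c = inj₁ (c , trans (head-view u) (cong₂ _∷_ head≡c tail≡c))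
...   | no head≢c  = inj₂ (inj₂ (inj₁ (head u , trans (head-view u)
                         (cong (head u ∷_) (trans tail≡c (cong (replicate _) (≢⇒≡not head≢c)))))))
shape-cases u | no ¬cᵢ | no ¬cₜ = inj₂ (inj₂ (inj₂ (¬cᵢ , ¬cₜ)))

T≡alt : ∀ n → T n ≡ alt false n
T≡alt zero    = refl
T≡alt (suc n) = trans (cong₂ _∷ʳ_ (T≡alt n) (lemma (even n))) (sym (alt-∷ʳ false n))
  where lemma : ∀ e → (if not e then true else false) ≡ (if e then false else true)
        lemma true  = refl
        lemma false = refl

CT≡alt : ∀ n → CT n ≡ alt true n
CT≡alt n = trans (cong (map not) (T≡alt n)) (map-not-alt false n)

ξₜ : ∀ {n} → Vec Bool n → Trit
ξₜ {zero}  [] = ⊙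
ξₜ {suc k} w with evenAtLeast2 (suc k) | w ≟ᵥ T (suc k) | w ≟ᵥ CT (suc k)
... | true | yes _ | _     = ⊕
... | true | no _  | yes _ = ⊖
... | _    | _     | _     = ξₜ (init w) ⊞ ξₜ (tail w)

ξ≡⟦ξₜ⟧ : ∀ {n} (w : Vec Bool n) → ξ w ≡ ⟦ ξₜ w ⟧
ξ≡⟦ξₜ⟧ {zero}  [] = refl
ξ≡⟦ξₜ⟧ {suc k} w with evenAtLeast2 (suc k) | w ≟ᵥ T (suc k) | w ≟ᵥ CT (suc k)
... | true  | yes _ | _     = refl
... | true  | no _  | yes _ = refl
... | true  | no _  | no _  = sgn-⟦⟧+⟦⟧ _ _ (ξ≡⟦ξₜ⟧ (init w)) (ξ≡⟦ξₜ⟧ (tail w))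
... | false | _     | _     = sgn-⟦⟧+⟦⟧ _ _ (ξ≡⟦ξₜ⟧ (init w)) (ξ≡⟦ξₜ⟧ (tail w))

φₜ : ∀ {n} → Vec Bool n → Trit
φₜ {zero}  [] = ⊙
φₜ {suc k} w with even (suc k) | w ≟ᵥ replicate (suc k) false | w ≟ᵥ replicate (suc k) true
... | false | yes _ | _     = ⊖
... | false | no _  | yes _ = ⊕
... | _     | _     | _     = φₜ (tail w) ⊟ φₜ (init w)

φ≡⟦φₜ⟧ : ∀ {n} (w : Vec Bool n) → φ w ≡ ⟦ φₜ w ⟧
φ≡⟦φₜ⟧ {zero}  [] = refl
φ≡⟦φₜ⟧ {suc k} w with even (suc k) | w ≟ᵥ replicate (suc k) false | w ≟ᵥ replicate (suc k) true
... | false | yes _ | _     = refl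
... | false | no _  | yes _ = refl
... | false | no _  | no _  = sgn-⟦⟧-⟦⟧ _ _ (φ≡⟦φₜ⟧ (tail w)) (φ≡⟦φₜ⟧ (init w))
... | true  | _     | _     = sgn-⟦⟧-⟦⟧ _ _ (φ≡⟦φₜ⟧ (tail w)) (φ≡⟦φₜ⟧ (init w))

ξₜ-step : ∀ {k} (w : Vec Bool (suc k)) →
          (evenAtLeast2 (suc k) ≡ true → ¬ IsAlternating w) → ξₜ w ≡ ξₜ (init w) ⊞ ξₜ (tail w)
ξₜ-step {k} w ¬base with evenAtLeast2 (suc k) | w ≟ᵥ T (suc k) | w ≟ᵥ CT (suc k)
... | true  | yes w≡T | _      = ⊥-elim (¬base refl (false , trans w≡T (T≡alt _)))
... | true  | no _    | yes w≡CT = ⊥-elim (¬base refl (true , trans w≡CT (CT≡alt _)))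
... | true  | no _    | no _   = refl
... | false | _       | _      = refl

ξₜ-step-odd : ∀ k (w : Vec Bool (suc (twice k))) → ξₜ w ≡ ξₜ (init w) ⊞ ξₜ (tail w)
ξₜ-step-odd k w = ξₜ-step w λ e → case trans (sym (evenAtLeast2-suc-twice k)) e of λ ()

ξₜ-step-nonalternating : ∀ {n} (w : Vec Bool (suc n)) → ¬ IsAlternating w → ξₜ w ≡ ξₜ (init w) ⊞ ξₜ (tail w)
ξₜ-step-nonalternating w ¬alt = ξₜ-step w λ _ → ¬alt

ξₜ-base : ∀ {k} (w : Vec Bool (suc k)) → evenAtLeast2 (suc k) ≡ true →
          ∀ b → w ≡ alt b (suc k) → ξₜ w ≡ -ₜ sign b
ξₜ-base {k} w e b w≡alt with evenAtLeast2 (suc k) | w ≟ᵥ T (suc k) | w ≟ᵥ CT (suc k)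
... | false | _       | _        = case e of λ ()
... | true  | yes w≡T | _        with alt-injective k (trans (sym w≡alt) (trans w≡T (T≡alt _)))
...   | refl = refl
ξₜ-base w e b w≡alt | true | no _ | yes w≡CT with alt-injective _ (trans (sym w≡alt) (trans w≡CT (CT≡alt _)))
...   | refl = refl
ξₜ-base w e false w≡alt | true | no w≢T | no _ = ⊥-elim (w≢T (trans w≡alt (sym (T≡alt _))))
ξₜ-base w e true  w≡alt | true | no _ | no w≢CT = ⊥-elim (w≢CT (trans w≡alt (sym (CT≡alt _))))

ξₜ-alternating : ∀ k b → ξₜ (alt b (twice (suc k))) ≡ -ₜ sign b
ξₜ-alternating k b = ξₜ-base {suc (twice k)} (alt b _) (even-twice k) b refl

φₜ-step : ∀ {k} (w : Vec Bool (suc k)) →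
          (even (suc k) ≡ false → ¬ IsConstant w) → φₜ w ≡ φₜ (tail w) ⊟ φₜ (init w)
φₜ-step {k} w ¬base with even (suc k) | w ≟ᵥ replicate (suc k) false | w ≟ᵥ replicate (suc k) true
... | false | yes w≡0s | _       = ⊥-elim (¬base refl (false , w≡0s))
... | false | no _    | yes w≡1s = ⊥-elim (¬base refl (true , w≡1s))
... | false | no _    | no _    = refl
... | true  | _       | _       = refl

φₜ-step-even : ∀ k (w : Vec Bool (twice (suc k))) → φₜ w ≡ φₜ (tail w) ⊟ φₜ (init w)
φₜ-step-even k w = φₜ-step w λ e → case trans (sym (even-twice (suc k))) e of λ ()

φₜ-step-nonconstant : ∀ {n} (w : Vec Bool (suc n)) → ¬ IsConstant w → φₜ w ≡ φₜ (tail w) ⊟ φₜ (init w)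
φₜ-step-nonconstant w ¬const = φₜ-step w λ _ → ¬const

φₜ-base : ∀ {k} (w : Vec Bool (suc k)) → even (suc k) ≡ false →
          ∀ c → w ≡ replicate (suc k) c → φₜ w ≡ sign c
φₜ-base {k} w e c w≡c with even (suc k) | w ≟ᵥ replicate (suc k) false | w ≟ᵥ replicate (suc k) true
... | true  | _        | _        = case e of λ ()
... | false | yes w≡0s | _        with cong head (trans (sym w≡c) w≡0s)
...   | refl = refl
φₜ-base w e c w≡c | false | no _ | yes w≡1s with cong head (trans (sym w≡c) w≡1s)
...   | refl = refl
φₜ-base w e false w≡c | false | no w≢0s | no _ = ⊥-elim (w≢0s w≡c)
φₜ-base w e true  w≡c | false | no _ | no w≢1s = ⊥-elim (w≢1s w≡c)

φₜ-odd-constant : ∀ m {c} {v : Vec Bool (suc (twice m))} → v ≡ replicate _ c → φₜ v ≡ sign c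
φₜ-odd-constant m {c} {v} = φₜ-base {twice m} v (even-suc-twice m) c

⊟-⊟-not-all-equal : ∀ a b c → a ≢ ⊙ → b ≢ ⊙ → c ≢ ⊙ → ¬ (a ≡ b × b ≡ c) → (c ⊟ b) ⊟ (b ⊟ a) ≡ -ₜ b
⊟-⊟-not-all-equal = decide

mutual
  φₜ-odd≢⊙ : ∀ m (u : Vec Bool (suc (twice m))) → φₜ u ≢ ⊙
  φₜ-odd≢⊙ m u with constant? u
  ... | yes (c , u≡c) = subst (_≢ ⊙) (sym (φₜ-odd-constant m u≡c)) (sign≢⊙ c)
  φₜ-odd≢⊙ zero    (x ∷ []) | no ¬const = ⊥-elim (¬const (x , refl))
  φₜ-odd≢⊙ (suc m) u        | no ¬const =
    subst (_≢ ⊙) (sym (φₜ-odd-peel m u ¬const)) (-ₜ-≢⊙ _ (φₜ-odd≢⊙ m (mid u)))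

  φₜ-odd-peel : ∀ m (u : Vec Bool (suc (twice (suc m)))) → ¬ IsConstant u → φₜ u ≡ -ₜ φₜ (mid u)
  φₜ-odd-peel m u ¬const = begin
    φₜ u
      ≡⟨ φₜ-step-nonconstant u ¬const ⟩
    φₜ (tail u) ⊟ φₜ (init u)
      ≡⟨ cong₂ _⊟_ (φₜ-step-even m (tail u)) (φₜ-step-even m (init u)) ⟩
    (φₜ (rr u) ⊟ φₜ (mid u)) ⊟ (φₜ (tail (init u)) ⊟ φₜ (ll u))
      ≡⟨ cong (λ v → (φₜ (rr u) ⊟ φₜ (mid u)) ⊟ (φₜ v ⊟ φₜ (ll u))) (tail-init u) ⟩
    (φₜ (rr u) ⊟ φₜ (mid u)) ⊟ (φₜ (mid u) ⊟ φₜ (ll u))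
      ≡⟨ ⊟-⊟-not-all-equal _ _ _ (φₜ-odd≢⊙ m (ll u)) (φₜ-odd≢⊙ m (mid u)) (φₜ-odd≢⊙ m (rr u))
           (φₜ-odd-not-all-equal m u ¬const) ⟩
    -ₜ φₜ (mid u) ∎
    where open ≡-Reasoning

  φₜ-odd-constant-then-nonconstant : ∀ m (p q : Vec Bool (suc (twice (suc m)))) → tail p ≡ init q →
                                     IsConstant p → ¬ IsConstant q → φₜ p ≢ φₜ q
  φₜ-odd-constant-then-nonconstant m p q tail≡init (c , p≡c) ¬const-q φp≡φq =
    ≢⊙⇒≢-ₜ (sign c) (sign≢⊙ c) (begin
      sign c          ≡⟨ sym (φₜ-odd-constant (suc m) p≡c) ⟩
      φₜ p            ≡⟨ φp≡φq ⟩
      φₜ q            ≡⟨ φₜ-odd-peel m q ¬const-q ⟩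
      -ₜ φₜ (mid q)   ≡⟨ cong (λ v → -ₜ φₜ v) (sym (trans (cong tail tail≡init) (tail-init q))) ⟩
      -ₜ φₜ (rr p)    ≡⟨ cong -ₜ_ (φₜ-odd-constant m (cong rr p≡c)) ⟩
      -ₜ sign c       ∎)
    where open ≡-Reasoning

  φₜ-odd-nonconstant-then-constant : ∀ m (p q : Vec Bool (suc (twice (suc m)))) → tail p ≡ init q →
                                     ¬ IsConstant p → IsConstant q → φₜ p ≢ φₜ q
  φₜ-odd-nonconstant-then-constant m p q tail≡init ¬const-p (c , q≡c) φp≡φq =
    ≢⊙⇒≢-ₜ (sign c) (sign≢⊙ c) (begin
      sign c          ≡⟨ sym (φₜ-odd-constant (suc m) q≡c) ⟩
      φₜ q            ≡⟨ sym φp≡φq ⟩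
      φₜ p            ≡⟨ φₜ-odd-peel m p ¬const-p ⟩
      -ₜ φₜ (mid p)   ≡⟨ cong (λ v → -ₜ φₜ (init v)) tail≡init ⟩
      -ₜ φₜ (ll q)    ≡⟨ cong -ₜ_ (φₜ-odd-constant m (trans (cong ll q≡c) (ll-replicate _ c))) ⟩
      -ₜ sign c       ∎)
    where open ≡-Reasoning

  φₜ-odd-not-all-equal : ∀ m (u : Vec Bool (suc (twice (suc m)))) → ¬ IsConstant u →
                         ¬ (φₜ (ll u) ≡ φₜ (mid u) × φₜ (mid u) ≡ φₜ (rr u))
  φₜ-odd-not-all-equal zero = decide
  φₜ-odd-not-all-equal (suc m) u ¬const (ll≡mid , mid≡rr)
    with constant? (ll u) | constant? (mid u) | constant? (rr u)
  ... | yes (x , ll≡x) | yes (y , mid≡y) | yes (z , rr≡z) = ¬const (x , glue-constant u init≡x tail≡y)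
    where
    init≡x : init u ≡ replicate _ x
    init≡x = glue-constant (init u) ll≡x (trans (tail-init u) mid≡y)
    tail≡y : tail u ≡ replicate _ y
    tail≡y = glue-constant (tail u) mid≡y rr≡z
  ... | no ¬c-ll | yes c-mid | _ = φₜ-odd-nonconstant-then-constant m (ll u) (mid u) (tail-ll u) ¬c-ll c-mid ll≡mid
  ... | yes c-ll | no ¬c-mid | _ = φₜ-odd-constant-then-nonconstant m (ll u) (mid u) (tail-ll u) c-ll ¬c-mid ll≡mid
  ... | _ | yes c-mid | no ¬c-rr = φₜ-odd-constant-then-nonconstant m (mid u) (rr u) (tail-init (tail u)) c-mid ¬c-rr mid≡rr
  ... | _ | no ¬c-mid | yes c-rr = φₜ-odd-nonconstant-then-constant m (mid u) (rr u) (tail-init (tail u)) ¬c-mid c-rr mid≡rr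
  ... | no ¬c-ll | no ¬c-mid | no ¬c-rr =
    φₜ-odd-not-all-equal m (mid u) ¬c-mid (inner-ll≡mid , inner-mid≡rr)
    where
    inner-ll≡mid : φₜ (ll (mid u)) ≡ φₜ (mid (mid u))
    inner-ll≡mid = -ₜ-injective _ _ (begin
      -ₜ φₜ (ll (mid u))    ≡⟨ cong (λ v → -ₜ φₜ v) (sym (mid-ll u)) ⟩
      -ₜ φₜ (mid (ll u))    ≡⟨ sym (φₜ-odd-peel m (ll u) ¬c-ll) ⟩
      φₜ (ll u)             ≡⟨ ll≡mid ⟩
      φₜ (mid u)            ≡⟨ φₜ-odd-peel m (mid u) ¬c-mid ⟩
      -ₜ φₜ (mid (mid u))   ∎)
      where open ≡-Reasoning
    inner-mid≡rr : φₜ (mid (mid u)) ≡ φₜ (rr (mid u))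
    inner-mid≡rr = -ₜ-injective _ _ (begin
      -ₜ φₜ (mid (mid u))   ≡⟨ sym (φₜ-odd-peel m (mid u) ¬c-mid) ⟩
      φₜ (mid u)            ≡⟨ mid≡rr ⟩
      φₜ (rr u)             ≡⟨ φₜ-odd-peel m (rr u) ¬c-rr ⟩
      -ₜ φₜ (mid (rr u))    ≡⟨ cong (λ v → -ₜ φₜ v) (mid-rr u) ⟩
      -ₜ φₜ (rr (mid u))    ∎)
      where open ≡-Reasoning

φₜ-init≢φₜ-tail : ∀ m (w : Vec Bool (suc (twice m))) → ¬ IsConstant w → φₜ (init w) ≢ φₜ (tail w)
φₜ-init≢φₜ-tail m w ¬const = ⊟≢⊙⇒≢ _ _ (subst (_≢ ⊙) (φₜ-step-nonconstant w ¬const) (φₜ-odd≢⊙ m w))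
  where
  ⊟≢⊙⇒≢ : ∀ a b → a ⊟ b ≢ ⊙ → b ≢ a
  ⊟≢⊙⇒≢ = decide

ξₜ-replicate : ∀ n c → ξₜ (replicate n c) ≡ ⊙
ξₜ-replicate zero          c = refl
ξₜ-replicate (suc zero)    c = refl
ξₜ-replicate (suc (suc n)) c = begin
  ξₜ (replicate (suc (suc n)) c)
    ≡⟨ ξₜ-step-nonalternating (replicate (suc (suc n)) c) (repeated-¬alternating c _) ⟩
  ξₜ (init (replicate (suc (suc n)) c)) ⊞ ξₜ (replicate (suc n) c)
    ≡⟨ cong₂ _⊞_ (trans (cong ξₜ (init-replicate (suc n) c)) (ξₜ-replicate (suc n) c)) (ξₜ-replicate (suc n) c) ⟩
  ⊙ ∎
  where open ≡-Reasoning

ξₜ≢⊙⇒¬constant : ∀ {n} {v : Vec Bool n} → ξₜ v ≢ ⊙ → ¬ IsConstant v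
ξₜ≢⊙⇒¬constant {n} ξ≢⊙ (c , refl) = ξ≢⊙ (ξₜ-replicate n c)

ξₜ-last-flipped : ∀ k a → ξₜ (replicate (suc k) a ∷ʳ not a) ≡ -ₜ sign a
ξₜ-last-flipped zero false = refl
ξₜ-last-flipped zero true  = refl
ξₜ-last-flipped (suc k) a = begin
  ξₜ (replicate (suc (suc k)) a ∷ʳ not a)
    ≡⟨ ξₜ-step-nonalternating (replicate (suc (suc k)) a ∷ʳ not a) (repeated-¬alternating a _) ⟩
  ξₜ (init (replicate (suc (suc k)) a ∷ʳ not a)) ⊞ ξₜ (replicate (suc k) a ∷ʳ not a)
    ≡⟨ cong₂ _⊞_ (trans (cong ξₜ (init-∷ʳ (not a) (replicate (suc (suc k)) a))) (ξₜ-replicate (suc (suc k)) a))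
                 (ξₜ-last-flipped k a) ⟩
  -ₜ sign a ∎
  where open ≡-Reasoning

ξₜ-first-flipped : ∀ k a → ξₜ (a ∷ replicate (suc k) (not a)) ≡ -ₜ sign a
ξₜ-first-flipped zero false = refl
ξₜ-first-flipped zero true  = refl
ξₜ-first-flipped (suc k) a = begin
  ξₜ (a ∷ replicate (suc (suc k)) (not a))
    ≡⟨ ξₜ-step-nonalternating (a ∷ replicate (suc (suc k)) (not a)) (∷-repeated-¬alternating a (not a) _) ⟩
  ξₜ (a ∷ init (replicate (suc (suc k)) (not a))) ⊞ ξₜ (replicate (suc (suc k)) (not a))
    ≡⟨ cong₂ _⊞_ (trans (cong (λ v → ξₜ (a ∷ v)) (init-replicate (suc k) (not a))) (ξₜ-first-flipped k a))
                 (ξₜ-replicate (suc (suc k)) (not a)) ⟩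
  -ₜ sign a ⊞ ⊙
    ≡⟨ ⊞-identityʳ (-ₜ sign a) ⟩
  -ₜ sign a ∎
  where
  open ≡-Reasoning
  ⊞-identityʳ : ∀ t → t ⊞ ⊙ ≡ t
  ⊞-identityʳ = decide

ξₜ-∷-replicate≡⊙ : ∀ k y a → ξₜ (y ∷ replicate (suc k) a) ≡ ⊙ → y ≡ a
ξₜ-∷-replicate≡⊙ k false false _ = refl
ξₜ-∷-replicate≡⊙ k true  true  _ = refl
ξₜ-∷-replicate≡⊙ k false true  ξ≡⊙ = case trans (sym (ξₜ-first-flipped k false)) ξ≡⊙ of λ ()
ξₜ-∷-replicate≡⊙ k true  false ξ≡⊙ = case trans (sym (ξₜ-first-flipped k true)) ξ≡⊙ of λ ()

ξₜ-replicate-∷ʳ≡⊙ : ∀ k a s → ξₜ (replicate (suc k) a ∷ʳ s) ≡ ⊙ → s ≡ a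
ξₜ-replicate-∷ʳ≡⊙ k false false _ = refl
ξₜ-replicate-∷ʳ≡⊙ k true  true  _ = refl
ξₜ-replicate-∷ʳ≡⊙ k false true  ξ≡⊙ = case trans (sym (ξₜ-last-flipped k false)) ξ≡⊙ of λ ()
ξₜ-replicate-∷ʳ≡⊙ k true  false ξ≡⊙ = case trans (sym (ξₜ-last-flipped k true)) ξ≡⊙ of λ ()

AlternatingPattern : Trit → Trit → Trit → Set
AlternatingPattern a b c = b ≢ ⊙ × a ≡ -ₜ b × c ≡ -ₜ b

ξ-combine : Trit → Trit → Trit → Trit
ξ-combine a b c = (a ⊞ b) ⊞ (b ⊞ c)

-- An alternating word of even length is a base case of ξ with value −s, where
-- (−s, s, −s) are the values on its inner factors; ξ-combine would give 0 there.
ξ-recurrence : Trit → Trit → Trit → Trit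
ξ-recurrence ⊖ ⊕ ⊖ = ⊖
ξ-recurrence ⊕ ⊖ ⊕ = ⊕
ξ-recurrence a b c = ξ-combine a b c

ξₜ-init-even : ∀ k (w : Vec Bool (twice (suc (suc k)))) → ξₜ (init w) ≡ ξₜ (ll w) ⊞ ξₜ (mid w)
ξₜ-init-even k w = trans (ξₜ-step-odd (suc k) (init w)) (cong (λ v → ξₜ (ll w) ⊞ ξₜ v) (tail-init w))

ξₜ-tail-even : ∀ k (w : Vec Bool (twice (suc (suc k)))) → ξₜ (tail w) ≡ ξₜ (mid w) ⊞ ξₜ (rr w)
ξₜ-tail-even k w = ξₜ-step-odd (suc k) (tail w)

ξₜ-even-combine : ∀ k (w : Vec Bool (twice (suc (suc k)))) → ¬ IsAlternating w →
                  ξₜ w ≡ ξ-combine (ξₜ (ll w)) (ξₜ (mid w)) (ξₜ (rr w))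
ξₜ-even-combine k w ¬alt =
  trans (ξₜ-step-nonalternating w ¬alt) (cong₂ _⊞_ (ξₜ-init-even k w) (ξₜ-tail-even k w))

ξₜ-even-recurrence : ∀ k (w : Vec Bool (twice (suc (suc k)))) →
                     (AlternatingPattern (ξₜ (ll w)) (ξₜ (mid w)) (ξₜ (rr w)) → IsAlternating w) →
                     ξₜ w ≡ ξ-recurrence (ξₜ (ll w)) (ξₜ (mid w)) (ξₜ (rr w))
ξₜ-even-recurrence k w pattern⇒alt with alternating? w
... | yes (b , refl) = begin
  ξₜ (alt b (twice (suc (suc k))))
    ≡⟨ ξₜ-alternating (suc k) b ⟩
  -ₜ sign b
    ≡⟨ alternating-case b ⟩
  ξ-recurrence (-ₜ sign b) (-ₜ sign (not b)) (-ₜ sign b)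
    ≡⟨ sym (cong₂ (λ x y → ξ-recurrence x y (-ₜ sign b)) ξ-ll ξ-mid) ⟩
  ξ-recurrence (ξₜ (ll w)) (ξₜ (mid w)) (-ₜ sign b)
    ≡⟨ sym (cong (ξ-recurrence (ξₜ (ll w)) (ξₜ (mid w))) ξ-rr) ⟩
  ξ-recurrence (ξₜ (ll w)) (ξₜ (mid w)) (ξₜ (rr w)) ∎
  where
  open ≡-Reasoning
  ξ-ll : ξₜ (ll (alt b (twice (suc (suc k))))) ≡ -ₜ sign b
  ξ-ll = trans (cong ξₜ (ll-alt b (twice (suc k)))) (ξₜ-alternating k b)
  ξ-mid : ξₜ (mid (alt b (twice (suc (suc k))))) ≡ -ₜ sign (not b)
  ξ-mid = trans (cong ξₜ (mid-alt b (twice (suc k)))) (ξₜ-alternating k (not b))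
  ξ-rr : ξₜ (rr (alt b (twice (suc (suc k))))) ≡ -ₜ sign b
  ξ-rr = trans (cong ξₜ (rr-alt b (twice (suc k)))) (ξₜ-alternating k b)
  alternating-case : ∀ b → -ₜ sign b ≡ ξ-recurrence (-ₜ sign b) (-ₜ sign (not b)) (-ₜ sign b)
  alternating-case false = refl
  alternating-case true  = refl
... | no ¬alt = trans (ξₜ-even-combine k w ¬alt) (sym (non-alternating-case _ _ _ (λ p → ¬alt (pattern⇒alt p))))
  where
  non-alternating-case : ∀ a b c → ¬ AlternatingPattern a b c → ξ-recurrence a b c ≡ ξ-combine a b c
  non-alternating-case = decide

record InnerSigns {n} (w : Vec Bool (suc (suc n))) : Set where
  field
    alternating   : AlternatingPattern (ξₜ (ll w)) (ξₜ (mid w)) (ξₜ (rr w)) → IsAlternating w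
    last-flipped  : ξₜ (ll w) ≡ ⊙ → ξₜ (mid w) ≡ ⊙ → ξₜ (rr w) ≢ ⊙ → LastFlipped w
    first-flipped : ξₜ (ll w) ≢ ⊙ → ξₜ (mid w) ≡ ⊙ → ξₜ (rr w) ≡ ⊙ → FirstFlipped w
    opposite      : ξₜ (ll w) ≢ ⊙ → ξₜ (mid w) ≡ ⊙ → ξₜ (rr w) ≢ ⊙ → ξₜ (rr w) ≡ -ₜ ξₜ (ll w)

instance
  dec-InnerSigns : ∀ {n} {w : Vec Bool (suc (suc n))} → Dec (InnerSigns w)
  dec-InnerSigns = map′ (λ (a , l , f , o) → record { alternating = a ; last-flipped = l ; first-flipped = f ; opposite = o })
                        (λ s → let open InnerSigns s in alternating , last-flipped , first-flipped , opposite)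
                        dec-×

last-flipped-extend : ∀ k (w : Vec Bool (suc (suc (suc (suc (suc (suc k))))))) →
                      LastFlipped (rr w) → ξₜ (ll (ll w)) ≡ ⊙ → ξₜ (mid (ll w)) ≡ ⊙ → LastFlipped w
last-flipped-extend k (x ∷ y ∷ _) (a , refl) ξ₀≡⊙ ξ₁≡⊙ = a , cong₂ (λ p q → p ∷ q ∷ v) x≡a y≡a
  where
  v : Vec Bool (suc (suc (suc (suc k))))
  v = replicate (suc (suc (suc k))) a ∷ʳ not a
  ll≡ : ll v ≡ replicate (suc (suc k)) a
  ll≡ = ll-replicate-∷ʳ (suc (suc k)) a (not a)
  y≡a : y ≡ a
  y≡a = ξₜ-∷-replicate≡⊙ k y a (begin
    ξₜ (y ∷ replicate (suc k) a)
      ≡⟨ cong (λ u → ξₜ (y ∷ u)) (sym (trans (cong init ll≡) (init-replicate (suc k) a))) ⟩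
    ξₜ (mid (ll (x ∷ y ∷ v)))
      ≡⟨ ξ₁≡⊙ ⟩
    ⊙                             ∎)
    where open ≡-Reasoning
  x≡a : x ≡ a
  x≡a = ξₜ-∷-replicate≡⊙ k x a (begin
    ξₜ (x ∷ a ∷ replicate k a)
      ≡⟨ cong₂ (λ q u → ξₜ (x ∷ q ∷ u)) (sym y≡a) (sym (trans (cong ll ll≡) (ll-replicate k a))) ⟩
    ξₜ (ll (ll (x ∷ y ∷ v)))
      ≡⟨ ξ₀≡⊙ ⟩
    ⊙                             ∎)
    where open ≡-Reasoning

first-flipped-extend : ∀ k (w : Vec Bool (suc (suc (suc (suc (suc (suc k))))))) →
                       FirstFlipped (ll w) → ξₜ (mid (rr w)) ≡ ⊙ → ξₜ (rr (rr w)) ≡ ⊙ → FirstFlipped w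
first-flipped-extend k w (a , ll≡) ξ₃≡⊙ ξ₄≡⊙ = a , (begin
  w
    ≡⟨ w≡ ⟩
  a ∷ ((replicate (suc (suc (suc k))) b ∷ʳ s) ∷ʳ t)
    ≡⟨ cong₂ (λ p q → a ∷ ((replicate (suc (suc (suc k))) b ∷ʳ p) ∷ʳ q)) s≡b t≡b ⟩
  a ∷ ((replicate (suc (suc (suc k))) b ∷ʳ b) ∷ʳ b)
    ≡⟨ cong (λ u → a ∷ (u ∷ʳ b)) (replicate-∷ʳ _ b) ⟩
  a ∷ (replicate (suc (suc (suc (suc k)))) b ∷ʳ b)
    ≡⟨ cong (a ∷_) (replicate-∷ʳ _ b) ⟩
  a ∷ replicate (suc (suc (suc (suc (suc k))))) b     ∎)
  where
  open ≡-Reasoning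
  b s t : Bool
  b = not a
  s = last (init w)
  t = last w
  w≡ : w ≡ a ∷ ((replicate (suc (suc (suc k))) b ∷ʳ s) ∷ʳ t)
  w≡ = trans (snoc-view₂ w) (cong (λ u → (u ∷ʳ s) ∷ʳ t) ll≡)
  s≡b : s ≡ b
  s≡b = ξₜ-replicate-∷ʳ≡⊙ k b s (begin
    ξₜ (replicate (suc k) b ∷ʳ s)
      ≡⟨ cong ξₜ (sym (init-∷ʳ t (replicate (suc k) b ∷ʳ s))) ⟩
    ξₜ (mid (rr (a ∷ ((replicate (suc (suc (suc k))) b ∷ʳ s) ∷ʳ t))))
      ≡⟨ cong (λ u → ξₜ (mid (rr u))) (sym w≡) ⟩
    ξₜ (mid (rr w))
      ≡⟨ ξ₃≡⊙ ⟩
    ⊙                                                ∎)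
  t≡b : t ≡ b
  t≡b = ξₜ-replicate-∷ʳ≡⊙ k b t (begin
    ξₜ (replicate (suc k) b ∷ʳ t)
      ≡⟨ cong (λ u → ξₜ (u ∷ʳ t)) (sym (trans (cong (replicate k b ∷ʳ_) s≡b) (replicate-∷ʳ k b))) ⟩
    ξₜ (rr (rr (a ∷ ((replicate (suc (suc (suc k))) b ∷ʳ s) ∷ʳ t))))
      ≡⟨ cong (λ u → ξₜ (rr (rr u))) (sym w≡) ⟩
    ξₜ (rr (rr w))
      ≡⟨ ξ₄≡⊙ ⟩
    ⊙                                                ∎)

flipped-clash : ∀ k (w : Vec Bool (suc (suc (suc (suc (suc (suc k))))))) →
                FirstFlipped (ll w) → LastFlipped (rr w) → ξₜ (rr (rr w)) ≢ ξₜ (ll (ll w))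
flipped-clash k w (a , ll≡) (c , rr≡) ξ₄≡ξ₀ = ≢⊙⇒≢-ₜ (sign a) (sign≢⊙ a) (begin
  sign a
    ≡⟨ sign-not c≡not-a ⟩
  -ₜ sign c
    ≡⟨ sym (ξₜ-last-flipped k c) ⟩
  ξₜ (replicate (suc k) c ∷ʳ not c)
    ≡⟨ cong (λ u → ξₜ (rr u)) (sym rr≡) ⟩
  ξₜ (rr (rr w))
    ≡⟨ ξ₄≡ξ₀ ⟩
  ξₜ (ll (ll w))
    ≡⟨ cong (λ u → ξₜ (ll u)) ll≡ ⟩
  ξₜ (a ∷ ll (replicate (suc (suc (suc k))) (not a)))
    ≡⟨ cong (λ u → ξₜ (a ∷ u)) (ll-replicate (suc k) (not a)) ⟩
  ξₜ (a ∷ replicate (suc k) (not a))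
    ≡⟨ ξₜ-first-flipped k a ⟩
  -ₜ sign a                            ∎)
  where
  open ≡-Reasoning
  c≡not-a : c ≡ not a
  c≡not-a = begin
    c                                  ≡⟨ cong head (sym rr≡) ⟩
    head (rr w)                        ≡⟨ head-rr-ll w ⟩
    head (rr (ll w))                   ≡⟨ cong (λ u → head (rr u)) ll≡ ⟩
    not a                              ∎
  sign-not : ∀ {c a} → c ≡ not a → sign a ≡ -ₜ sign c
  sign-not {a = false} refl = refl
  sign-not {a = true}  refl = refl

recurrence-alternating : ∀ d₀ d₁ d₂ d₃ d₄ →
  AlternatingPattern (ξ-recurrence d₀ d₁ d₂) (ξ-recurrence d₁ d₂ d₃) (ξ-recurrence d₂ d₃ d₄) →
  AlternatingPattern d₀ d₁ d₂ × AlternatingPattern d₂ d₃ d₄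
recurrence-alternating = decide

recurrence-last-flipped : ∀ d₀ d₁ d₂ d₃ d₄ →
  ξ-recurrence d₀ d₁ d₂ ≡ ⊙ → ξ-recurrence d₁ d₂ d₃ ≡ ⊙ → ξ-recurrence d₂ d₃ d₄ ≢ ⊙ →
  d₀ ≡ ⊙ × d₁ ≡ ⊙ × d₂ ≡ ⊙ × d₃ ≡ ⊙ × d₄ ≢ ⊙
recurrence-last-flipped = decide

recurrence-first-flipped : ∀ d₀ d₁ d₂ d₃ d₄ →
  ξ-recurrence d₀ d₁ d₂ ≢ ⊙ → ξ-recurrence d₁ d₂ d₃ ≡ ⊙ → ξ-recurrence d₂ d₃ d₄ ≡ ⊙ →
  d₀ ≢ ⊙ × d₁ ≡ ⊙ × d₂ ≡ ⊙ × d₃ ≡ ⊙ × d₄ ≡ ⊙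
recurrence-first-flipped = decide

recurrence-opposite : ∀ d₀ d₁ d₂ d₃ d₄ →
  ξ-recurrence d₀ d₁ d₂ ≢ ⊙ → ξ-recurrence d₁ d₂ d₃ ≡ ⊙ → ξ-recurrence d₂ d₃ d₄ ≢ ⊙ →
  ξ-recurrence d₂ d₃ d₄ ≡ -ₜ ξ-recurrence d₀ d₁ d₂ ⊎ (d₀ ≢ ⊙ × d₁ ≡ ⊙ × d₂ ≡ ⊙ × d₃ ≡ ⊙ × d₄ ≡ d₀)
recurrence-opposite = decide

innerSigns-step : ∀ m (w : Vec Bool (twice (suc (suc (suc m))))) →
                  InnerSigns (ll w) → InnerSigns (mid w) → InnerSigns (rr w) → InnerSigns w
innerSigns-step m w Sₗ Sₘ Sᵣ = record
  { alternating   = alternating′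
  ; last-flipped  = last-flipped′
  ; first-flipped = first-flipped′
  ; opposite      = opposite′
  }
  where
  module Sₗ = InnerSigns Sₗ
  module Sₘ = InnerSigns Sₘ
  module Sᵣ = InnerSigns Sᵣ
  d₀ d₁ d₂ d₃ d₄ : Trit
  d₀ = ξₜ (ll (ll w))
  d₁ = ξₜ (mid (ll w))
  d₂ = ξₜ (mid (mid w))
  d₃ = ξₜ (mid (rr w))
  d₄ = ξₜ (rr (rr w))
  rr-ll≡ : ξₜ (rr (ll w)) ≡ d₂
  rr-ll≡ = cong ξₜ (rr-ll w)
  ll-rr≡ : ξₜ (ll (rr w)) ≡ d₂
  ll-rr≡ = cong ξₜ (ll-rr w)
  e₀ : ξₜ (ll w) ≡ ξ-recurrence d₀ d₁ d₂
  e₀ = trans (ξₜ-even-recurrence m (ll w) Sₗ.alternating) (cong (ξ-recurrence d₀ d₁) rr-ll≡)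
  e₁ : ξₜ (mid w) ≡ ξ-recurrence d₁ d₂ d₃
  e₁ = trans (ξₜ-even-recurrence m (mid w) Sₘ.alternating)
             (cong₂ (λ x z → ξ-recurrence x d₂ z) (cong ξₜ (sym (mid-ll w))) (cong ξₜ (sym (mid-rr w))))
  e₂ : ξₜ (rr w) ≡ ξ-recurrence d₂ d₃ d₄
  e₂ = trans (ξₜ-even-recurrence m (rr w) Sᵣ.alternating) (cong (λ x → ξ-recurrence x d₃ d₄) ll-rr≡)

  alternating′ : AlternatingPattern (ξₜ (ll w)) (ξₜ (mid w)) (ξₜ (rr w)) → IsAlternating w
  alternating′ p =
    let pₗ , pᵣ = recurrence-alternating d₀ d₁ d₂ d₃ d₄ (subst₃ AlternatingPattern e₀ e₁ e₂ p)
    in alternating-glue w (Sₗ.alternating (subst₃ AlternatingPattern refl refl (sym rr-ll≡) pₗ))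
                          (Sᵣ.alternating (subst₃ AlternatingPattern (sym ll-rr≡) refl refl pᵣ))

  last-flipped′ : ξₜ (ll w) ≡ ⊙ → ξₜ (mid w) ≡ ⊙ → ξₜ (rr w) ≢ ⊙ → LastFlipped w
  last-flipped′ z₀ z₁ n₂ =
    let d₀≡⊙ , d₁≡⊙ , d₂≡⊙ , d₃≡⊙ , d₄≢⊙ = recurrence-last-flipped d₀ d₁ d₂ d₃ d₄
                                              (trans (sym e₀) z₀) (trans (sym e₁) z₁) (λ q → n₂ (trans e₂ q))
    in last-flipped-extend (twice m) w (Sᵣ.last-flipped (trans ll-rr≡ d₂≡⊙) d₃≡⊙ d₄≢⊙) d₀≡⊙ d₁≡⊙

  first-flipped′ : ξₜ (ll w) ≢ ⊙ → ξₜ (mid w) ≡ ⊙ → ξₜ (rr w) ≡ ⊙ → FirstFlipped w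
  first-flipped′ n₀ z₁ z₂ =
    let d₀≢⊙ , d₁≡⊙ , d₂≡⊙ , d₃≡⊙ , d₄≡⊙ = recurrence-first-flipped d₀ d₁ d₂ d₃ d₄
                                              (λ q → n₀ (trans e₀ q)) (trans (sym e₁) z₁) (trans (sym e₂) z₂)
    in first-flipped-extend (twice m) w (Sₗ.first-flipped d₀≢⊙ d₁≡⊙ (trans rr-ll≡ d₂≡⊙)) d₃≡⊙ d₄≡⊙

  opposite′ : ξₜ (ll w) ≢ ⊙ → ξₜ (mid w) ≡ ⊙ → ξₜ (rr w) ≢ ⊙ → ξₜ (rr w) ≡ -ₜ ξₜ (ll w)
  opposite′ n₀ z₁ n₂
    with recurrence-opposite d₀ d₁ d₂ d₃ d₄ (λ q → n₀ (trans e₀ q)) (trans (sym e₁) z₁) (λ q → n₂ (trans e₂ q))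
  ... | inj₁ e₂≡-e₀ = trans e₂ (trans e₂≡-e₀ (cong -ₜ_ (sym e₀)))
  ... | inj₂ (d₀≢⊙ , d₁≡⊙ , d₂≡⊙ , d₃≡⊙ , d₄≡d₀) =
    ⊥-elim (flipped-clash (twice m) w (Sₗ.first-flipped d₀≢⊙ d₁≡⊙ (trans rr-ll≡ d₂≡⊙))
                                      (Sᵣ.last-flipped (trans ll-rr≡ d₂≡⊙) d₃≡⊙ (λ q → d₀≢⊙ (trans (sym d₄≡d₀) q)))
                                      d₄≡d₀)

innerSigns : ∀ m (w : Vec Bool (twice (suc m))) → InnerSigns w
innerSigns zero          = decide
innerSigns (suc zero)    = decide
innerSigns (suc (suc m)) w =
  innerSigns-step m w (innerSigns (suc m) (ll w)) (innerSigns (suc m) (mid w)) (innerSigns (suc m) (rr w))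

φₜ-even-constant : ∀ k c → φₜ (replicate (twice (suc k)) c) ≡ ⊙
φₜ-even-constant k c = begin
  φₜ (replicate (twice (suc k)) c)
    ≡⟨ φₜ-step-even k _ ⟩
  φₜ (replicate (suc (twice k)) c) ⊟ φₜ (init (replicate (twice (suc k)) c))
    ≡⟨ cong₂ _⊟_ (φₜ-odd-constant k refl) (φₜ-odd-constant k (init-replicate _ c)) ⟩
  sign c ⊟ sign c
    ≡⟨ ⊟-self (sign c) ⟩
  ⊙ ∎
  where
  open ≡-Reasoning
  ⊟-self : ∀ t → t ⊟ t ≡ ⊙
  ⊟-self = decide

φₜ-last-flipped≢⊙ : ∀ k c → φₜ (replicate (suc (twice (suc k))) c ∷ʳ not c) ≢ ⊙
φₜ-last-flipped≢⊙ k c = subst (_≢ ⊙) (sym φ≡) (-t⊟t≢⊙ (sign c) (sign≢⊙ c))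
  where
  v : Vec Bool (twice (suc (suc k)))
  v = replicate (suc (twice (suc k))) c ∷ʳ not c
  φ≡ : φₜ v ≡ -ₜ sign c ⊟ sign c
  φ≡ = begin
    φₜ v
      ≡⟨ φₜ-step-even (suc k) v ⟩
    φₜ (tail v) ⊟ φₜ (init v)
      ≡⟨ cong₂ _⊟_ (φₜ-odd-peel k (tail v) (last-flipped-nonconstant (tail v) (c , refl)))
                   (φₜ-odd-constant (suc k) (init-∷ʳ (not c) _)) ⟩
    -ₜ φₜ (mid (tail v)) ⊟ sign c
      ≡⟨ cong (λ t → -ₜ t ⊟ sign c) (φₜ-odd-constant k (init-∷ʳ (not c) _)) ⟩
    -ₜ sign c ⊟ sign c ∎
    where open ≡-Reasoning
  -t⊟t≢⊙ : ∀ t → t ≢ ⊙ → -ₜ t ⊟ t ≢ ⊙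
  -t⊟t≢⊙ = decide

φₜ-first-flipped≢⊙ : ∀ k a → φₜ (a ∷ replicate (suc (twice (suc k))) (not a)) ≢ ⊙
φₜ-first-flipped≢⊙ k a = subst (_≢ ⊙) (sym φ≡) (t⊟-t≢⊙ (sign (not a)) (sign≢⊙ (not a)))
  where
  v : Vec Bool (twice (suc (suc k)))
  v = a ∷ replicate (suc (twice (suc k))) (not a)
  init≡ : init v ≡ a ∷ replicate (twice (suc k)) (not a)
  init≡ = cong (a ∷_) (init-replicate _ (not a))
  φ≡ : φₜ v ≡ sign (not a) ⊟ -ₜ sign (not a)
  φ≡ = begin
    φₜ v
      ≡⟨ φₜ-step-even (suc k) v ⟩
    φₜ (tail v) ⊟ φₜ (init v)
      ≡⟨ cong₂ _⊟_ (φₜ-odd-constant (suc k) refl)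
                   (φₜ-odd-peel k (init v) (first-flipped-nonconstant (init v) (a , init≡))) ⟩
    sign (not a) ⊟ -ₜ φₜ (mid (init v))
      ≡⟨ cong (λ t → sign (not a) ⊟ -ₜ t) (φₜ-odd-constant k (trans (cong mid init≡) (init-replicate _ (not a)))) ⟩
    sign (not a) ⊟ -ₜ sign (not a) ∎
    where open ≡-Reasoning
  t⊟-t≢⊙ : ∀ t → t ≢ ⊙ → t ⊟ -ₜ t ≢ ⊙
  t⊟-t≢⊙ = decide

φₜ-init-peel : ∀ k (u : Vec Bool (twice (suc (suc k)))) → ¬ IsConstant (init u) →
               φₜ (init u) ≡ -ₜ φₜ (init (mid u))
φₜ-init-peel k u ¬c = trans (φₜ-odd-peel k (init u) ¬c) (cong (λ v → -ₜ φₜ (init v)) (tail-init u))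

φₜ-tail-peel : ∀ k (u : Vec Bool (twice (suc (suc k)))) → ¬ IsConstant (tail u) →
               φₜ (tail u) ≡ -ₜ φₜ (tail (mid u))
φₜ-tail-peel k u ¬c = trans (φₜ-odd-peel k (tail u) ¬c) (cong (λ v → -ₜ φₜ v) (sym (tail-init (tail u))))

φₜ-even-peel : ∀ k (u : Vec Bool (twice (suc (suc k)))) → ¬ IsConstant (init u) → ¬ IsConstant (tail u) →
               φₜ u ≡ -ₜ φₜ (mid u)
φₜ-even-peel k u ¬cᵢ ¬cₜ = begin
  φₜ u
    ≡⟨ φₜ-step-even (suc k) u ⟩
  φₜ (tail u) ⊟ φₜ (init u)
    ≡⟨ cong₂ _⊟_ (φₜ-tail-peel k u ¬cₜ) (φₜ-init-peel k u ¬cᵢ) ⟩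
  -ₜ φₜ (tail (mid u)) ⊟ -ₜ φₜ (init (mid u))
    ≡⟨ -ₜ⊟-ₜ (φₜ (tail (mid u))) (φₜ (init (mid u))) ⟩
  -ₜ (φₜ (tail (mid u)) ⊟ φₜ (init (mid u)))
    ≡⟨ cong -ₜ_ (sym (φₜ-step-even k (mid u))) ⟩
  -ₜ φₜ (mid u) ∎
  where
  open ≡-Reasoning
  -ₜ⊟-ₜ : ∀ p q → -ₜ p ⊟ -ₜ q ≡ -ₜ (p ⊟ q)
  -ₜ⊟-ₜ = decide

ξₜ-even≡⊙⇔ξₜ-mid≡⊙ : ∀ k (u : Vec Bool (twice (suc (suc k)))) → ¬ IsConstant (init u) → ¬ IsConstant (tail u) →
                     ξₜ u ≡ ⊙ ⇔ ξₜ (mid u) ≡ ⊙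
ξₜ-even≡⊙⇔ξₜ-mid≡⊙ k u ¬cᵢ ¬cₜ =
  subst (λ t → t ≡ ⊙ ⇔ ξₜ (mid u) ≡ ⊙) (sym (ξₜ-even-recurrence k u S.alternating))
        (mk⇔ (proj₁ zero-iff) (proj₂ zero-iff))
  where
  module S = InnerSigns (innerSigns (suc k) u)
  not-last-flipped : ¬ (ξₜ (ll u) ≡ ⊙ × ξₜ (mid u) ≡ ⊙ × ξₜ (rr u) ≢ ⊙)
  not-last-flipped (z₀ , z₁ , n₂) with S.last-flipped z₀ z₁ n₂
  ... | a , refl = ¬cᵢ (a , init-∷ʳ (not a) _)
  not-first-flipped : ¬ (ξₜ (ll u) ≢ ⊙ × ξₜ (mid u) ≡ ⊙ × ξₜ (rr u) ≡ ⊙)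
  not-first-flipped (n₀ , z₁ , z₂) with S.first-flipped n₀ z₁ z₂
  ... | a , refl = ¬cₜ (not a , refl)
  recurrence≡⊙⇔ : ∀ a b c → ¬ (a ≡ ⊙ × b ≡ ⊙ × c ≢ ⊙) → ¬ (a ≢ ⊙ × b ≡ ⊙ × c ≡ ⊙) →
                  (a ≢ ⊙ → b ≡ ⊙ → c ≢ ⊙ → c ≡ -ₜ a) →
                  (ξ-recurrence a b c ≡ ⊙ → b ≡ ⊙) × (b ≡ ⊙ → ξ-recurrence a b c ≡ ⊙)
  recurrence≡⊙⇔ = decide
  zero-iff : (ξ-recurrence (ξₜ (ll u)) (ξₜ (mid u)) (ξₜ (rr u)) ≡ ⊙ → ξₜ (mid u) ≡ ⊙)
           × (ξₜ (mid u) ≡ ⊙ → ξ-recurrence (ξₜ (ll u)) (ξₜ (mid u)) (ξₜ (rr u)) ≡ ⊙)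
  zero-iff = recurrence≡⊙⇔ _ _ _ not-last-flipped not-first-flipped S.opposite

ξₜ≡⊙⇔φₜ≡⊙-step : ∀ k (u : Vec Bool (twice (suc (suc k)))) →
                   (ξₜ (mid u) ≡ ⊙ ⇔ φₜ (mid u) ≡ ⊙) → ξₜ u ≡ ⊙ ⇔ φₜ u ≡ ⊙
ξₜ≡⊙⇔φₜ≡⊙-step k u mid⇔ with shape-cases u
... | inj₁ (c , refl) =
  mk⇔ (λ _ → φₜ-even-constant (suc k) c) (λ _ → ξₜ-replicate (twice (suc (suc k))) c)
... | inj₂ (inj₁ (c , refl)) =
  mk⇔ (λ ξ≡⊙ → ⊥-elim (-ₜ-≢⊙ _ (sign≢⊙ c) (trans (sym (ξₜ-last-flipped (twice (suc k)) c)) ξ≡⊙)))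
      (λ φ≡⊙ → ⊥-elim (φₜ-last-flipped≢⊙ k c φ≡⊙))
... | inj₂ (inj₂ (inj₁ (a , refl))) =
  mk⇔ (λ ξ≡⊙ → ⊥-elim (-ₜ-≢⊙ _ (sign≢⊙ a) (trans (sym (ξₜ-first-flipped (twice (suc k)) a)) ξ≡⊙)))
      (λ φ≡⊙ → ⊥-elim (φₜ-first-flipped≢⊙ k a φ≡⊙))
... | inj₂ (inj₂ (inj₂ (¬cᵢ , ¬cₜ))) = begin
  ξₜ u ≡ ⊙                ≈⟨ ξₜ-even≡⊙⇔ξₜ-mid≡⊙ k u ¬cᵢ ¬cₜ ⟩
  ξₜ (mid u) ≡ ⊙          ≈⟨ mid⇔ ⟩
  φₜ (mid u) ≡ ⊙          ≈⟨ mk⇔ (proj₁ (≡⊙⇔-ₜ≡⊙ _)) (proj₂ (≡⊙⇔-ₜ≡⊙ _)) ⟩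
  -ₜ φₜ (mid u) ≡ ⊙       ≡⟨ cong (_≡ ⊙) (sym (φₜ-even-peel k u ¬cᵢ ¬cₜ)) ⟩
  φₜ u ≡ ⊙                ∎
  where
  open import Relation.Binary.Reasoning.Setoid (⇔-setoid 0ℓ)
  ≡⊙⇔-ₜ≡⊙ : ∀ t → (t ≡ ⊙ → -ₜ t ≡ ⊙) × (-ₜ t ≡ ⊙ → t ≡ ⊙)
  ≡⊙⇔-ₜ≡⊙ = decide

ξₜ≡⊙⇔φₜ≡⊙ : ∀ m (u : Vec Bool (twice m)) → ξₜ u ≡ ⊙ ⇔ φₜ u ≡ ⊙
ξₜ≡⊙⇔φₜ≡⊙ zero          [] = mk⇔ (λ _ → refl) (λ _ → refl)
ξₜ≡⊙⇔φₜ≡⊙ (suc zero)    u  = mk⇔ (proj₁ (length-2 u)) (proj₂ (length-2 u))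
  where
  length-2 : ∀ (u : Vec Bool 2) → (ξₜ u ≡ ⊙ → φₜ u ≡ ⊙) × (φₜ u ≡ ⊙ → ξₜ u ≡ ⊙)
  length-2 = decide
ξₜ≡⊙⇔φₜ≡⊙ (suc (suc k)) u = ξₜ≡⊙⇔φₜ≡⊙-step k u (ξₜ≡⊙⇔φₜ≡⊙ (suc k) (mid u))

⟦⟧^twice-suc : ∀ t k → ⟦ t ⟧ ^ twice (suc k) ≡ ⟦ t ⊠ t ⟧
⟦⟧^twice-suc t zero    = square t
  where
  square : ∀ t → ⟦ t ⟧ * (⟦ t ⟧ * 1ℤ) ≡ ⟦ t ⊠ t ⟧
  square = decide
⟦⟧^twice-suc t (suc k) = trans (cong (λ x → ⟦ t ⟧ * (⟦ t ⟧ * x)) (⟦⟧^twice-suc t k)) (square-idempotent t)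
  where
  square-idempotent : ∀ t → ⟦ t ⟧ * (⟦ t ⟧ * ⟦ t ⊠ t ⟧) ≡ ⟦ t ⊠ t ⟧
  square-idempotent = decide

⟦⟧^suc-twice : ∀ t k → ⟦ t ⟧ ^ suc (twice k) ≡ ⟦ t ⟧
⟦⟧^suc-twice t zero    = ℤ.*-identityʳ ⟦ t ⟧
⟦⟧^suc-twice t (suc k) = trans (cong (⟦ t ⟧ *_) (⟦⟧^twice-suc t k)) (cube t)
  where
  cube : ∀ t → ⟦ t ⟧ * ⟦ t ⊠ t ⟧ ≡ ⟦ t ⟧
  cube = decide

ψ-even : ∀ k (v : Vec Bool (twice (suc k))) → ψ v ≡ ⟦ ξₜ v ⊠ ξₜ v ⊠ φₜ v ⟧
ψ-even k v = begin
  ξ v ^ twice (suc k) * φ v              ≡⟨ cong₂ (λ x y → x ^ twice (suc k) * y) (ξ≡⟦ξₜ⟧ v) (φ≡⟦φₜ⟧ v) ⟩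
  ⟦ ξₜ v ⟧ ^ twice (suc k) * ⟦ φₜ v ⟧    ≡⟨ cong (_* ⟦ φₜ v ⟧) (⟦⟧^twice-suc (ξₜ v) k) ⟩
  ⟦ ξₜ v ⊠ ξₜ v ⟧ * ⟦ φₜ v ⟧             ≡⟨ ⟦⟧*⟦⟧ (ξₜ v ⊠ ξₜ v) (φₜ v) ⟩
  ⟦ ξₜ v ⊠ ξₜ v ⊠ φₜ v ⟧                 ∎
  where open ≡-Reasoning

ψ-odd : ∀ k (v : Vec Bool (suc (twice k))) → ψ v ≡ ⟦ ξₜ v ⊠ φₜ v ⟧
ψ-odd k v = begin
  ξ v ^ suc (twice k) * φ v              ≡⟨ cong₂ (λ x y → x ^ suc (twice k) * y) (ξ≡⟦ξₜ⟧ v) (φ≡⟦φₜ⟧ v) ⟩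
  ⟦ ξₜ v ⟧ ^ suc (twice k) * ⟦ φₜ v ⟧    ≡⟨ cong (_* ⟦ φₜ v ⟧) (⟦⟧^suc-twice (ξₜ v) k) ⟩
  ⟦ ξₜ v ⟧ * ⟦ φₜ v ⟧                    ≡⟨ ⟦⟧*⟦⟧ (ξₜ v) (φₜ v) ⟩
  ⟦ ξₜ v ⊠ φₜ v ⟧                        ∎
  where open ≡-Reasoning

colourable⇒≢⊙ : ∀ {n} {v : Vec Bool n} {t} → ψ v ≡ ⟦ t ⟧ → Colourable v → t ≢ ⊙
colourable⇒≢⊙ ψ≡ colourable t≡⊙ = colourable (trans ψ≡ (cong ⟦_⟧ t≡⊙))

ψ-init≢ψ-tail-odd-length : ∀ k (w : Vec Bool (suc (twice k))) →
                           Colourable (init w) → Colourable (tail w) → ψ (init w) ≢ ψ (tail w)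
ψ-init≢ψ-tail-odd-length zero    (x ∷ []) colourableₗ _ _ = colourableₗ refl
ψ-init≢ψ-tail-odd-length (suc k) w colourableₗ _ ψ≡ = φₜ-init≢φₜ-tail (suc k) w ¬constant φ≡
  where
  nonzero : ξₜ (init w) ⊠ ξₜ (init w) ⊠ φₜ (init w) ≢ ⊙
  nonzero = colourable⇒≢⊙ {v = init w} (ψ-even k (init w)) colourableₗ
  squares-cancel : ∀ a b p q → a ⊠ a ⊠ p ≢ ⊙ → a ⊠ a ⊠ p ≡ b ⊠ b ⊠ q → p ≡ q
  squares-cancel = decide
  φ≡ : φₜ (init w) ≡ φₜ (tail w)
  φ≡ = squares-cancel (ξₜ (init w)) (ξₜ (tail w)) _ _ nonzero
         (⟦⟧-injective _ _ (trans (sym (ψ-even k (init w))) (trans ψ≡ (ψ-even k (tail w)))))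
  ¬constant : ¬ IsConstant w
  ¬constant (c , refl) =
    ξₜ≢⊙⇒¬constant {v = init w} (λ ξ≡⊙ → nonzero (cong (λ a → a ⊠ a ⊠ φₜ (init w)) ξ≡⊙)) (c , init-replicate _ c)

ψ-init≢ψ-tail-even-length : ∀ k (w : Vec Bool (twice (suc k))) →
                            Colourable (init w) → Colourable (tail w) → ψ (init w) ≢ ψ (tail w)
ψ-init≢ψ-tail-even-length zero    (x ∷ y ∷ []) colourableₗ _ _ = colourableₗ refl
ψ-init≢ψ-tail-even-length (suc k) w colourableₗ colourableᵣ ψ≡ =
  products-distinct _ _ _ _ _ S.opposite (Equivalence.to mid⇔) (Equivalence.from mid⇔)
    (subst (_≢ ⊙) (ξₜ-init-even k w) ξₗ≢⊙) (subst (_≢ ⊙) (ξₜ-tail-even k w) ξᵣ≢⊙)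
    (φₜ-odd≢⊙ k (init (mid w))) (φₜ-odd≢⊙ k (tail (mid w)))
    (⟦⟧-injective _ _ (begin
      ⟦ (ξₜ (ll w) ⊞ ξₜ (mid w)) ⊠ -ₜ φₜ (init (mid w)) ⟧
        ≡⟨ cong ⟦_⟧ (sym (cong₂ _⊠_ (ξₜ-init-even k w) (φₜ-init-peel k w (ξₜ≢⊙⇒¬constant ξₗ≢⊙)))) ⟩
      ⟦ ξₜ (init w) ⊠ φₜ (init w) ⟧
        ≡⟨ sym (ψ-odd (suc k) (init w)) ⟩
      ψ (init w)
        ≡⟨ ψ≡ ⟩
      ψ (tail w)
        ≡⟨ ψ-odd (suc k) (tail w) ⟩
      ⟦ ξₜ (tail w) ⊠ φₜ (tail w) ⟧
        ≡⟨ cong ⟦_⟧ (cong₂ _⊠_ (ξₜ-tail-even k w) (φₜ-tail-peel k w (ξₜ≢⊙⇒¬constant ξᵣ≢⊙))) ⟩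
      ⟦ (ξₜ (mid w) ⊞ ξₜ (rr w)) ⊠ -ₜ φₜ (tail (mid w)) ⟧  ∎))
  where
  open ≡-Reasoning
  module S = InnerSigns (innerSigns (suc k) w)
  products-distinct : ∀ e₀ e₁ e₂ p q → (e₀ ≢ ⊙ → e₁ ≡ ⊙ → e₂ ≢ ⊙ → e₂ ≡ -ₜ e₀) →
                      (e₁ ≡ ⊙ → q ⊟ p ≡ ⊙) → (q ⊟ p ≡ ⊙ → e₁ ≡ ⊙) → e₀ ⊞ e₁ ≢ ⊙ → e₁ ⊞ e₂ ≢ ⊙ → p ≢ ⊙ → q ≢ ⊙ →
                      (e₀ ⊞ e₁) ⊠ -ₜ p ≢ (e₁ ⊞ e₂) ⊠ -ₜ q
  products-distinct = decide
  mid⇔ : ξₜ (mid w) ≡ ⊙ ⇔ φₜ (tail (mid w)) ⊟ φₜ (init (mid w)) ≡ ⊙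
  mid⇔ = subst (λ t → ξₜ (mid w) ≡ ⊙ ⇔ t ≡ ⊙) (φₜ-step-even k (mid w)) (ξₜ≡⊙⇔φₜ≡⊙ (suc k) (mid w))
  ξₗ≢⊙ : ξₜ (init w) ≢ ⊙
  ξₗ≢⊙ ξ≡⊙ = colourable⇒≢⊙ {v = init w} (ψ-odd (suc k) (init w)) colourableₗ (cong (_⊠ φₜ (init w)) ξ≡⊙)
  ξᵣ≢⊙ : ξₜ (tail w) ≢ ⊙
  ξᵣ≢⊙ ξ≡⊙ = colourable⇒≢⊙ {v = tail w} (ψ-odd (suc k) (tail w)) colourableᵣ (cong (_⊠ φₜ (tail w)) ξ≡⊙)

corollary5p6 : (n : ℕ) (w : Vec Bool (suc n)) →
    Colourable (init w) → Colourable (tail w) → ψ (init w) ≢ ψ (tail w)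
corollary5p6 n w with parity n
... | even-length k = ψ-init≢ψ-tail-odd-length k w
... | odd-length k  = ψ-init≢ψ-tail-even-length k w
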